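{- Let $\Phi=(\phi_j)_{j=1}^n$ and $\Psi=(\psi_j)_{j=1}^n$ be frames for a $d$-dimensional non-isotropic space $V$ over $\mathbb{F}$, and let $\eta_{j,k,\phi}$, $\eta_{j,k,\psi}$ denote their exponential gauges. Then $\Phi$ and $\Psi$ are switching equivalent if and only if: (i) $\Delta(\phi_j,\phi_k)=\Delta(\psi_j,\psi_k)$ for all $j,k\in[n]$; and (ii) there exist $\beta_1,\dots,\beta_n\in\mathbb{F}$ with $\beta_j\beta_j^\sigma=1$ for all $j$ such that $\eta_{j,k,\psi}=\eta_{j,k,\phi}\beta_j^\sigma\beta_k$ for all $j,k\in[n]$.
   Context: $\mathbb{F}$ is a finite field of one of two kinds: (Case U) $\mathbb{F}=\mathbb{F}_{q^2}$ with involution $x^\sigma=x^q$, or (Case O) $\mathbb{F}=\mathbb{F}_q$ with $x^\sigma=x$; in both cases $q$ is odd. A non-isotropic space is a finite-dimensional $\mathbb{F}$-vector space with a non-degenerate Hermitian scalar product $\langle\cdot,\cdot\rangle$ (linear in the second argument, $\langle u,v\rangle=\langle v,u\rangle^\sigma$, non-degenerate). A frame for $V$ is a sequence of vectors spanning $V$. A unitary $U:V\to V$ is an invertible linear map preserving $\langle\cdot,\cdot\rangle$; $\Phi,\Psi$ are switching equivalent if there are a unitary $U$ and $t_1,\dots,t_n$ with $t_it_i^\sigma=1$ such that $\psi_j=t_jU\phi_j$ for all $j$. Double products: $\Delta(\phi_j,\phi_k)=\langle\phi_j,\phi_k\rangle\langle\phi_k,\phi_j\rangle$. Fix once and for all a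 function $\sqrt{\cdot}$ on $\{xx^\sigma:x\in\mathbb{F}^\times\}$ with $(\sqrt{y})^2=y$ (such square roots exist since $q$ is odd). The exponential gauge is $\eta_{j,k}=\langle\phi_j,\phi_k\rangle/\sqrt{\Delta(\phi_j,\phi_k)}$ if $\Delta(\phi_j,\phi_k)\neq0$, and $\eta_{j,k}=0$ otherwise. -}

module Defs where

open import Level using (_⊔_) renaming (suc to lsuc)
open import Data.Nat using (ℕ) renaming (_+_ to _+ℕ_; _*_ to _*ℕ_)
open import Data.Fin using (Fin)
open import Data.Product using (Σ; ∃; _×_; _,_)
open import Data.Sum using (_⊎_)
open import Relation.Nullary using (¬_; yes; no)
open import Relation.Binary.Definitions using (Decidable)
open import Relation.Binary.PropositionalEquality using (_≡_)
open import Algebra.Bundles using (CommutativeRing; Semiring)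
import Algebra.Definitions.RawSemiring as RS

-- A field: a commutative ring with 0 ≠ 1, a multiplicative inverse for
-- every non-zero element (the value of _⁻¹ at 0 is irrelevant), and a
-- decision procedure for equality (available for every concrete finite field;
-- it is needed to define the exponential gauge by cases).
record Field c ℓ : Set (lsuc (c ⊔ ℓ)) where
  field
    commutativeRing : CommutativeRing c ℓ
  open CommutativeRing commutativeRing public
  field
    _⁻¹       : Carrier → Carrier
    ⁻¹-inverse : ∀ x → x ≉ 0# → x * (x ⁻¹) ≈ 1#
    0≉1       : 0# ≉ 1#
    _≟_       : Decidable _≈_
  open RS (Semiring.rawSemiring semiring) public using (_^_; sum)

IsFiniteOfCard : ∀ {c ℓ} → Field c ℓ → ℕ → Set (c ⊔ ℓ)
IsFiniteOfCard F N = Σ (Fin N → Carrier) λ e →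
    (∀ x → ∃ λ i → e i ≈ x) × (∀ i j → e i ≈ e j → i ≡ j)
  where open Field F

Odd : ℕ → Set
Odd q = ∃ λ k → q ≡ 1 +ℕ 2 *ℕ k

-- The standing setting: F is F_{q²} with σ(x) = x^q (Case U) or F_q with
-- σ(x) = x = x^q (Case O), q odd.  In both cases σ(x) = x ^ q.
FiniteFieldSetting : ∀ {c ℓ} → Field c ℓ → ℕ → Set (c ⊔ ℓ)
FiniteFieldSetting F q =
  Odd q × ∃ λ N → IsFiniteOfCard F N × (N ≡ q *ℕ q ⊎ N ≡ q)

module Space {c ℓ} (F : Field c ℓ) (σ : Field.Carrier F → Field.Carrier F) (d : ℕ) where
  open Field F

  -- V = F^d (every d-dimensional space is of this form)
  V : Set c
  V = Fin d → Carrier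

  _≈V_ : V → V → Set ℓ
  u ≈V v = ∀ a → u a ≈ v a

  _+V_ : V → V → V
  (u +V v) a = u a + v a

  _·V_ : Carrier → V → V
  (x ·V v) a = x * v a

  -- a non-degenerate Hermitian scalar product on V (linear in the 2nd argument)
  record IsNonIsotropic (B : V → V → Carrier) : Set (c ⊔ ℓ) where
    field
      cong       : ∀ {u u' v v'} → u ≈V u' → v ≈V v' → B u v ≈ B u' v'
      +-linear   : ∀ u v w → B u (v +V w) ≈ B u v + B u w
      ·-linear   : ∀ u x v → B u (x ·V v) ≈ x * B u v
      hermitian  : ∀ u v → B u v ≈ σ (B v u)
      nondegen   : ∀ u → (∀ v → B u v ≈ 0#) → ∀ a → u a ≈ 0#

  IsFrame : ∀ {n} → (Fin n → V) → Set (c ⊔ ℓ)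
  IsFrame {n} φ = ∀ (v : V) → ∃ λ (x : Fin n → Carrier) → ∀ (a : Fin d) → v a ≈ sum {n} (λ j → x j * φ j a)

  IsUnitScalar : Carrier → Set ℓ
  IsUnitScalar t = t * σ t ≈ 1#

  module _ (B : V → V → Carrier) where

    record IsUnitary (U : V → V) : Set (c ⊔ ℓ) where
      field
        cong      : ∀ {u v} → u ≈V v → U u ≈V U v
        +-linear  : ∀ u v → U (u +V v) ≈V (U u +V U v)
        ·-linear  : ∀ x v → U (x ·V v) ≈V (x ·V U v)
        inverse   : Σ (V → V) λ W → (∀ {u v} → u ≈V v → W u ≈V W v)
                      × (∀ v → W (U v) ≈V v) × (∀ v → U (W v) ≈V v)
        preserves : ∀ u v → B (U u) (U v) ≈ B u v

    SwitchingEquivalent : ∀ {n} → (Fin n → V) → (Fin n → V) → Set (c ⊔ ℓ)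
    SwitchingEquivalent {n} φ ψ =
      Σ (V → V) λ U → IsUnitary U × Σ (Fin n → Carrier) λ t →
        (∀ j → IsUnitScalar (t j)) × (∀ j → ψ j ≈V (t j ·V U (φ j)))

    Δ : ∀ {n} → (Fin n → V) → Fin n → Fin n → Carrier
    Δ φ j k = B (φ j) (φ k) * B (φ k) (φ j)

    η : ∀ {n} → (Carrier → Carrier) → (Fin n → V) → Fin n → Fin n → Carrier
    η sqrt φ j k with Δ φ j k ≟ 0#
    ... | yes _ = 0#
    ... | no  _ = B (φ j) (φ k) * (sqrt (Δ φ j k) ⁻¹)

  IsSqrtOnNorms : (Carrier → Carrier) → Set (c ⊔ ℓ)
  IsSqrtOnNorms sqrt = (∀ {x y} → x ≈ y → sqrt x ≈ sqrt y)
    × (∀ x → x ≉ 0# → sqrt (x * σ x) * sqrt (x * σ x) ≈ x * σ x)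

-- Switching equivalence is the same as the Gram matrices agreeing up to unit
-- rescaling, B (ψ j) (ψ k) = σ(βⱼ) βₖ B (φ j) (φ k): two spanning families with
-- equal Gram matrices differ by a unitary, since by nondegeneracy a vector is
-- determined by its pairings with a spanning family.  The rescaled-Gram
-- condition in turn splits into equal double products and rescaled gauges,
-- because B (φ j) (φ k) = η j k · √Δ j k when Δ j k ≠ 0, while B (φ j) (φ k) = 0
-- when Δ j k = 0.
module Submission where

open import Defs
open import Level using (_⊔_)
open import Data.Nat using (ℕ)
open import Data.Fin using (Fin)
open import Data.Product using (Σ; _×_; _,_; proj₁; proj₂)
open import Data.Empty using (⊥-elim)
open import Function.Bundles using (_⇔_; mk⇔; Equivalence)
open import Data.Sum using ([_,_]′)
open import Relation.Nullary.Decidable using (yes; no; toSum)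
import Relation.Binary.PropositionalEquality as ≡
import Relation.Binary.Reasoning.Setoid as ≈-Reasoning
import Data.Vec.Functional.Relation.Binary.Equality.Setoid as VecEquality
import Algebra.Properties.Ring as RingProperties
import Algebra.Properties.Group as GroupProperties
import Algebra.Properties.Semiring.Sum as SumProperties
import Algebra.Properties.Semiring.Exp as ExpProperties
import Algebra.Properties.CommutativeSemiring.Exp as CommExpProperties
import Algebra.Solver.Ring.NaturalCoefficients.Default as Solver

module FieldProperties {c ℓ} (F : Field c ℓ) where
  open Field F
  open ≈-Reasoning setoid

  *-cancelʳ-≉0 : ∀ {s x y} → s ≉ 0# → x * s ≈ y * s → x ≈ y
  *-cancelʳ-≉0 {s} {x} {y} s≉0 xs≈ys = begin
    x              ≈⟨ *-identityʳ x ⟨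
    x * 1#         ≈⟨ *-congˡ (⁻¹-inverse s s≉0) ⟨
    x * (s * s ⁻¹) ≈⟨ *-assoc x s _ ⟨
    (x * s) * s ⁻¹ ≈⟨ *-congʳ xs≈ys ⟩
    (y * s) * s ⁻¹ ≈⟨ *-assoc y s _ ⟩
    y * (s * s ⁻¹) ≈⟨ *-congˡ (⁻¹-inverse s s≉0) ⟩
    y * 1#         ≈⟨ *-identityʳ y ⟩
    y              ∎

  x≉0∧x*y≈0⇒y≈0 : ∀ {x y} → x ≉ 0# → x * y ≈ 0# → y ≈ 0#
  x≉0∧x*y≈0⇒y≈0 {x} {y} x≉0 xy≈0 =
    *-cancelʳ-≉0 x≉0 (trans (*-comm y x) (trans xy≈0 (sym (zeroˡ x))))

  *-inverseʳ-cancel : ∀ {s} → s ≉ 0# → ∀ x → (x * s ⁻¹) * s ≈ x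
  *-inverseʳ-cancel {s} s≉0 x = begin
    (x * s ⁻¹) * s ≈⟨ *-assoc x _ s ⟩
    x * (s ⁻¹ * s) ≈⟨ *-congˡ (*-comm _ s) ⟩
    x * (s * s ⁻¹) ≈⟨ *-congˡ (⁻¹-inverse s s≉0) ⟩
    x * 1#         ≈⟨ *-identityʳ x ⟩
    x              ∎

module Conjugation {c ℓ} (F : Field c ℓ) (q : ℕ) (q-odd : Odd q) where
  open Field F
  open ≈-Reasoning setoid
  open Solver commutativeSemiring using (solve; _:=_; _:*_)

  σ : Carrier → Carrier
  σ x = x ^ q

  σ-cong : ∀ {x y} → x ≈ y → σ x ≈ σ y
  σ-cong = ExpProperties.^-congˡ semiring q

  σ-distrib-* : ∀ x y → σ (x * y) ≈ σ x * σ y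
  σ-distrib-* x y = CommExpProperties.^-distrib-* commutativeSemiring x y q

  0^odd≈0 : ∀ {m} → Odd m → 0# ^ m ≈ 0#
  0^odd≈0 (_ , ≡.refl) = zeroˡ _

  σ-0 : σ 0# ≈ 0#
  σ-0 = 0^odd≈0 q-odd

  unit-insert : ∀ {t} → t * σ t ≈ 1# → ∀ x y → x * y ≈ (x * σ t) * (t * y)
  unit-insert {t} t-unit x y = begin
    x * y                    ≈⟨ *-identityʳ _ ⟨
    (x * y) * 1#             ≈⟨ *-congˡ t-unit ⟨
    (x * y) * (t * σ t)      ≈⟨ solve 4 (λ x y t s → (x :* y) :* (t :* s) := (x :* s) :* (t :* y)) refl x y t (σ t) ⟩
    (x * σ t) * (t * y)      ∎

module HermitianSpace {c ℓ} (F : Field c ℓ) (q : ℕ) (q-odd : Odd q) (d : ℕ) where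
  open Field F
  open FieldProperties F
  open Conjugation F q q-odd
  open Space F σ d
  open ≈-Reasoning setoid
  open VecEquality setoid using (≋-refl; ≋-sym; ≋-trans)
  open SumProperties semiring using (sum-cong-≋; ∑-distrib-+; *-distribˡ-sum)
  open Solver commutativeSemiring using (solve; _:=_; _:*_)

  linComb : ∀ {n} → (Fin n → Carrier) → (Fin n → V) → V
  linComb x a i = sum (λ j → x j * a j i)

  linComb-+ : ∀ {n} (x y : Fin n → Carrier) a →
              linComb (λ j → x j + y j) a ≈V (linComb x a +V linComb y a)
  linComb-+ {n} x y a i =
    trans (sum-cong-≋ {n} (λ j → distribʳ (a j i) (x j) (y j))) (∑-distrib-+ {n} _ _)

  linComb-· : ∀ {n} s (x : Fin n → Carrier) a →
              linComb (λ j → s * x j) a ≈V (s ·V linComb x a)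
  linComb-· {n} s x a i =
    trans (sum-cong-≋ {n} (λ j → *-assoc s (x j) (a j i))) (sym (*-distribˡ-sum {n} s _))

  module Form {B : V → V → Carrier} (B-nonIsotropic : IsNonIsotropic B) where
    open IsNonIsotropic B-nonIsotropic renaming (cong to B-cong)

    B-congˡ : ∀ {u u'} v → u ≈V u' → B u v ≈ B u' v
    B-congˡ v u≈u' = B-cong u≈u' ≋-refl

    B-congʳ : ∀ u {v v'} → v ≈V v' → B u v ≈ B u v'
    B-congʳ u v≈v' = B-cong ≋-refl v≈v'

    B-linComb : ∀ {n} u (x : Fin n → Carrier) a →
                B u (linComb x a) ≈ sum (λ k → x k * B u (a k))
    B-linComb {ℕ.zero} u x a = begin
      B u (λ _ → 0#)  ≈⟨ B-congʳ u (λ i → sym (zeroˡ (u i))) ⟩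
      B u (0# ·V u)   ≈⟨ ·-linear u 0# u ⟩
      0# * B u u      ≈⟨ zeroˡ _ ⟩
      0#              ∎
    B-linComb {ℕ.suc n} u x a = begin
      B u (linComb x a)
        ≈⟨ +-linear u _ _ ⟩
      B u (x Fin.zero ·V a Fin.zero) + B u (linComb (λ j → x (Fin.suc j)) (λ j → a (Fin.suc j)))
        ≈⟨ +-cong (·-linear u _ _) (B-linComb u (λ j → x (Fin.suc j)) (λ j → a (Fin.suc j))) ⟩
      sum (λ k → x k * B u (a k)) ∎

    B-scale : ∀ s u r v → B (s ·V u) (r ·V v) ≈ (σ s * r) * B u v
    B-scale s u r v = begin
      B (s ·V u) (r ·V v)    ≈⟨ ·-linear _ r v ⟩
      r * B (s ·V u) v       ≈⟨ *-congˡ (hermitian _ v) ⟩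
      r * σ (B v (s ·V u))   ≈⟨ *-congˡ (σ-cong (·-linear v s u)) ⟩
      r * σ (s * B v u)      ≈⟨ *-congˡ (σ-distrib-* s _) ⟩
      r * (σ s * σ (B v u))  ≈⟨ *-congˡ (*-congˡ (sym (hermitian u v))) ⟩
      r * (σ s * B u v)      ≈⟨ solve 3 (λ r s b → r :* (s :* b) := (s :* r) :* b) refl r (σ s) (B u v) ⟩
      (σ s * r) * B u v      ∎

    ≈V-by-pairing : ∀ {u v} → (∀ w → B w u ≈ B w v) → u ≈V v
    ≈V-by-pairing {u} {v} Bu≈Bv i = x∙y⁻¹≈ε⇒x≈y (u i) (v i)
      (trans (+-congˡ (sym (-1*x≈-x (v i)))) (nondegen u-v u-v⊥ i))
      where
      open GroupProperties +-group using (x∙y⁻¹≈ε⇒x≈y)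
      open RingProperties ring using (-1*x≈-x)
      u-v : V
      u-v = u +V ((- 1#) ·V v)
      u-v⊥ : ∀ w → B u-v w ≈ 0#
      u-v⊥ w = begin
        B u-v w                         ≈⟨ hermitian u-v w ⟩
        σ (B w u-v)                     ≈⟨ σ-cong (+-linear w u _) ⟩
        σ (B w u + B w ((- 1#) ·V v))   ≈⟨ σ-cong (+-cong (Bu≈Bv w) (·-linear w (- 1#) v)) ⟩
        σ (B w v + (- 1#) * B w v)      ≈⟨ σ-cong (+-congˡ (-1*x≈-x _)) ⟩
        σ (B w v - B w v)               ≈⟨ σ-cong (-‿inverseʳ _) ⟩
        σ 0#                            ≈⟨ σ-0 ⟩
        0#                              ∎

    B*B≈0⇒B≈0 : ∀ u v → B u v * B v u ≈ 0# → B u v ≈ 0#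
    B*B≈0⇒B≈0 u v BB≈0 with B u v ≟ 0#
    ... | yes Buv≈0 = Buv≈0
    ... | no  Buv≉0 = trans (hermitian u v) (trans (σ-cong (x≉0∧x*y≈0⇒y≈0 Buv≉0 BB≈0)) σ-0)

    module Transport {n} {a b : Fin n → V} (a-frame : IsFrame a) (b-frame : IsFrame b)
                     (Gram≈ : ∀ j k → B (b j) (b k) ≈ B (a j) (a k)) where

      coords : V → Fin n → Carrier
      coords v = proj₁ (a-frame v)

      coords-spec : ∀ v → v ≈V linComb (coords v) a
      coords-spec v = proj₂ (a-frame v)

      U : V → V
      U v = linComb (coords v) b

      -- The first slot is reached through Hermitian symmetry: σ is multiplicative
      -- but not assumed additive.
      B-linComb-basis : ∀ z k → B (linComb z b) (b k) ≈ B (linComb z a) (a k)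
      B-linComb-basis z k = begin
        B (linComb z b) (b k)                ≈⟨ hermitian _ _ ⟩
        σ (B (b k) (linComb z b))            ≈⟨ σ-cong (B-linComb (b k) z b) ⟩
        σ (sum (λ j → z j * B (b k) (b j)))  ≈⟨ σ-cong (sum-cong-≋ {n} (λ j → *-congˡ (Gram≈ k j))) ⟩
        σ (sum (λ j → z j * B (a k) (a j)))  ≈⟨ σ-cong (B-linComb (a k) z a) ⟨
        σ (B (a k) (linComb z a))            ≈⟨ hermitian _ _ ⟨
        B (linComb z a) (a k)                ∎

      B-linComb-linComb : ∀ z x → B (linComb z b) (linComb x b) ≈ B (linComb z a) (linComb x a)
      B-linComb-linComb z x = begin
        B (linComb z b) (linComb x b)          ≈⟨ B-linComb _ x b ⟩
        sum (λ k → x k * B (linComb z b) (b k)) ≈⟨ sum-cong-≋ {n} (λ k → *-congˡ (B-linComb-basis z k)) ⟩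
        sum (λ k → x k * B (linComb z a) (a k)) ≈⟨ B-linComb _ x a ⟨
        B (linComb z a) (linComb x a)          ∎

      ≈V-by-pairing-with-b : ∀ {u v} → (∀ z → B (linComb z b) u ≈ B (linComb z b) v) → u ≈V v
      ≈V-by-pairing-with-b {u} {v} pairing≈ = ≈V-by-pairing λ w →
        let (z , w≈) = b-frame w in
        trans (B-congˡ u w≈) (trans (pairing≈ z) (sym (B-congˡ v w≈)))

      linComb-transport : ∀ {x y} → linComb x a ≈V linComb y a → linComb x b ≈V linComb y b
      linComb-transport {x} {y} xa≈ya = ≈V-by-pairing-with-b λ z → begin
        B (linComb z b) (linComb x b)  ≈⟨ B-linComb-linComb z x ⟩
        B (linComb z a) (linComb x a)  ≈⟨ B-congʳ _ xa≈ya ⟩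
        B (linComb z a) (linComb y a)  ≈⟨ B-linComb-linComb z y ⟨
        B (linComb z b) (linComb y b)  ∎

      U-linComb : ∀ x {v} → v ≈V linComb x a → U v ≈V linComb x b
      U-linComb x {v} v≈xa = linComb-transport (≋-trans (≋-sym (coords-spec v)) v≈xa)

      U-cong : ∀ {u v} → u ≈V v → U u ≈V U v
      U-cong {u} {v} u≈v = U-linComb (coords v) (≋-trans u≈v (coords-spec v))

      U-basis : ∀ j → U (a j) ≈V b j
      U-basis j = ≈V-by-pairing-with-b λ z → begin
        B (linComb z b) (U (a j))                 ≈⟨ B-linComb-linComb z _ ⟩
        B (linComb z a) (linComb (coords (a j)) a) ≈⟨ B-congʳ _ (coords-spec (a j)) ⟨
        B (linComb z a) (a j)                     ≈⟨ B-linComb-basis z j ⟨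
        B (linComb z b) (b j)                     ∎

      U-preserves : ∀ u v → B (U u) (U v) ≈ B u v
      U-preserves u v = trans (B-linComb-linComb (coords u) (coords v))
                              (sym (B-cong (coords-spec u) (coords-spec v)))

      U-+ : ∀ u v → U (u +V v) ≈V (U u +V U v)
      U-+ u v = ≋-trans
        (U-linComb (λ j → coords u j + coords v j)
          (≋-trans (λ i → +-cong (coords-spec u i) (coords-spec v i)) (≋-sym (linComb-+ _ _ a))))
        (linComb-+ _ _ b)

      U-· : ∀ s v → U (s ·V v) ≈V (s ·V U v)
      U-· s v = ≋-trans
        (U-linComb (λ j → s * coords v j)
          (≋-trans (λ i → *-congˡ (coords-spec v i)) (≋-sym (linComb-· s _ a))))
        (linComb-· s _ b)

    equal-Gram⇒unitary : ∀ {n} {a b : Fin n → V} → IsFrame a → IsFrame b →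
                         (∀ j k → B (b j) (b k) ≈ B (a j) (a k)) →
                         Σ (V → V) λ U → IsUnitary B U × (∀ j → U (a j) ≈V b j)
    equal-Gram⇒unitary a-frame b-frame Gram≈ = A.U , isUnitary , A.U-basis
      where
      module A = Transport a-frame b-frame Gram≈
      module A⁻¹ = Transport b-frame a-frame (λ j k → sym (Gram≈ j k))
      isUnitary : IsUnitary B A.U
      isUnitary = record
        { cong      = A.U-cong
        ; +-linear  = A.U-+
        ; ·-linear  = A.U-·
        ; inverse   = A⁻¹.U , A⁻¹.U-cong
                    , (λ v → ≋-trans (A⁻¹.U-linComb _ ≋-refl) (≋-sym (A.coords-spec v)))
                    , (λ v → ≋-trans (A.U-linComb _ ≋-refl) (≋-sym (A⁻¹.coords-spec v)))
        ; preserves = A.U-preserves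
        }

    GramRescaled : ∀ {n} → (Fin n → Carrier) → (Fin n → V) → (Fin n → V) → Set ℓ
    GramRescaled β φ ψ = ∀ j k → B (ψ j) (ψ k) ≈ (σ (β j) * β k) * B (φ j) (φ k)

    rescale-IsFrame : ∀ {n} {β : Fin n → Carrier} {φ : Fin n → V} →
                      (∀ j → IsUnitScalar (β j)) → IsFrame φ → IsFrame (λ j → β j ·V φ j)
    rescale-IsFrame {n} {β} {φ} β-unit φ-frame v =
      let (x , v≈xφ) = φ-frame v in
      (λ j → x j * σ (β j)) ,
      λ i → trans (v≈xφ i) (sum-cong-≋ {n} (λ j → unit-insert (β-unit j) (x j) (φ j i)))

    GramRescaledByUnits : ∀ {n} → (Fin n → V) → (Fin n → V) → Set (c ⊔ ℓ)
    GramRescaledByUnits {n} φ ψ =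
      Σ (Fin n → Carrier) λ β → (∀ j → IsUnitScalar (β j)) × GramRescaled β φ ψ

    switching⇔GramRescaledByUnits : ∀ {n} {φ ψ : Fin n → V} → IsFrame φ → IsFrame ψ →
                             SwitchingEquivalent B φ ψ ⇔ GramRescaledByUnits φ ψ
    switching⇔GramRescaledByUnits {φ = φ} {ψ} φ-frame ψ-frame = mk⇔ switching⇒ switching⇐
      where
      switching⇒ : SwitchingEquivalent B φ ψ → GramRescaledByUnits φ ψ
      switching⇒ (U , U-unitary , t , t-unit , ψ≈tUφ) = t , t-unit , λ j k →
        trans (B-cong (ψ≈tUφ j) (ψ≈tUφ k))
              (trans (B-scale _ _ _ _) (*-congˡ (IsUnitary.preserves U-unitary _ _)))

      switching⇐ : GramRescaledByUnits φ ψ → SwitchingEquivalent B φ ψ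
      switching⇐ (β , β-unit , rescaled) =
        let α = λ j → β j ·V φ j
            (U , U-unitary , Uα≈ψ) = equal-Gram⇒unitary {a = α} (rescale-IsFrame β-unit φ-frame) ψ-frame
                                       (λ j k → trans (rescaled j k) (sym (B-scale _ _ _ _)))
        in U , U-unitary , β , β-unit ,
           λ j → ≋-trans (≋-sym (Uα≈ψ j)) (IsUnitary.·-linear U-unitary (β j) (φ j))

    module Gauge {sqrt : Carrier → Carrier} (sqrt-spec : IsSqrtOnNorms sqrt) where
      sqrt-cong : ∀ {x y} → x ≈ y → sqrt x ≈ sqrt y
      sqrt-cong = proj₁ sqrt-spec

      GaugeRescaled : ∀ {n} → (Fin n → Carrier) → (Fin n → V) → (Fin n → V) → Set ℓ
      GaugeRescaled β φ ψ = ∀ j k → η B sqrt ψ j k ≈ (η B sqrt φ j k * σ (β j)) * β k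

      η-zero : ∀ {n} (φ : Fin n → V) j k → Δ B φ j k ≈ 0# → η B sqrt φ j k ≈ 0#
      η-zero φ j k Δ≈0 with Δ B φ j k ≟ 0#
      ... | yes _   = refl
      ... | no Δ≉0 = ⊥-elim (Δ≉0 Δ≈0)

      sqrtΔ≉0 : ∀ {n} (φ : Fin n → V) j k → Δ B φ j k ≉ 0# → sqrt (Δ B φ j k) ≉ 0#
      sqrtΔ≉0 φ j k Δ≉0 sqrtΔ≈0 = Δ≉0 (begin
        Δ B φ j k                        ≈⟨ Δ≈norm ⟩
        x * σ x                          ≈⟨ proj₂ sqrt-spec x x≉0 ⟨
        sqrt (x * σ x) * sqrt (x * σ x)  ≈⟨ *-cong sqrt≈0 sqrt≈0 ⟩
        0# * 0#                          ≈⟨ zeroˡ 0# ⟩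
        0#                               ∎)
        where
        x : Carrier
        x = B (φ j) (φ k)
        Δ≈norm : Δ B φ j k ≈ x * σ x
        Δ≈norm = *-congˡ (hermitian (φ k) (φ j))
        x≉0 : x ≉ 0#
        x≉0 x≈0 = Δ≉0 (trans (*-congʳ x≈0) (zeroˡ _))
        sqrt≈0 : sqrt (x * σ x) ≈ 0#
        sqrt≈0 = trans (sqrt-cong (sym Δ≈norm)) sqrtΔ≈0

      η-polar : ∀ {n} (φ : Fin n → V) j k → Δ B φ j k ≉ 0# →
                η B sqrt φ j k * sqrt (Δ B φ j k) ≈ B (φ j) (φ k)
      η-polar φ j k Δ≉0 with Δ B φ j k ≟ 0#
      ... | yes Δ≈0 = ⊥-elim (Δ≉0 Δ≈0)
      ... | no _    = *-inverseʳ-cancel (sqrtΔ≉0 φ j k Δ≉0) _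

      module _ {n} {β : Fin n → Carrier} {φ ψ : Fin n → V} where

        GramRescaled⇒Δ≈ : (∀ j → IsUnitScalar (β j)) → GramRescaled β φ ψ →
                          ∀ j k → Δ B φ j k ≈ Δ B ψ j k
        GramRescaled⇒Δ≈ β-unit rescaled j k = sym (begin
          B (ψ j) (ψ k) * B (ψ k) (ψ j)
            ≈⟨ *-cong (rescaled j k) (rescaled k j) ⟩
          ((σ (β j) * β k) * B (φ j) (φ k)) * ((σ (β k) * β j) * B (φ k) (φ j))
            ≈⟨ solve 6 (λ a a' b b' x y → ((a' :* b) :* x) :* ((b' :* a) :* y) := ((a :* a') :* (b :* b')) :* (x :* y))
                     refl (β j) (σ (β j)) (β k) (σ (β k)) (B (φ j) (φ k)) (B (φ k) (φ j)) ⟩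
          ((β j * σ (β j)) * (β k * σ (β k))) * Δ B φ j k
            ≈⟨ *-congʳ (*-cong (β-unit j) (β-unit k)) ⟩
          (1# * 1#) * Δ B φ j k
            ≈⟨ trans (*-congʳ (*-identityˡ 1#)) (*-identityˡ _) ⟩
          Δ B φ j k ∎)

        GramRescaled⇒GaugeRescaled : (∀ j k → Δ B φ j k ≈ Δ B ψ j k) → GramRescaled β φ ψ →
                                     GaugeRescaled β φ ψ
        GramRescaled⇒GaugeRescaled Δ≈ rescaled j k =
          [ Δ≈0-case , Δ≉0-case ]′ (toSum (Δ B φ j k ≟ 0#))
          where
          Δ≈0-case : Δ B φ j k ≈ 0# → η B sqrt ψ j k ≈ (η B sqrt φ j k * σ (β j)) * β k
          Δ≈0-case Δφ≈0 = begin
            η B sqrt ψ j k                        ≈⟨ η-zero ψ j k (trans (sym (Δ≈ j k)) Δφ≈0) ⟩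
            0#                                    ≈⟨ trans (*-congʳ (zeroˡ _)) (zeroˡ _) ⟨
            (0# * σ (β j)) * β k                  ≈⟨ *-congʳ (*-congʳ (η-zero φ j k Δφ≈0)) ⟨
            (η B sqrt φ j k * σ (β j)) * β k      ∎

          Δ≉0-case : Δ B φ j k ≉ 0# → η B sqrt ψ j k ≈ (η B sqrt φ j k * σ (β j)) * β k
          Δ≉0-case Δφ≉0 = *-cancelʳ-≉0 (sqrtΔ≉0 ψ j k Δψ≉0) (begin
            η B sqrt ψ j k * sqrt (Δ B ψ j k)                     ≈⟨ η-polar ψ j k Δψ≉0 ⟩
            B (ψ j) (ψ k)                                         ≈⟨ rescaled j k ⟩
            (σ (β j) * β k) * B (φ j) (φ k)                       ≈⟨ *-congˡ (η-polar φ j k Δφ≉0) ⟨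
            (σ (β j) * β k) * (η B sqrt φ j k * sqrt (Δ B φ j k))
              ≈⟨ solve 4 (λ a b e s → (a :* b) :* (e :* s) := ((e :* a) :* b) :* s)
                       refl (σ (β j)) (β k) (η B sqrt φ j k) (sqrt (Δ B φ j k)) ⟩
            ((η B sqrt φ j k * σ (β j)) * β k) * sqrt (Δ B φ j k) ≈⟨ *-congˡ (sqrt-cong (Δ≈ j k)) ⟩
            ((η B sqrt φ j k * σ (β j)) * β k) * sqrt (Δ B ψ j k) ∎)
            where
            Δψ≉0 : Δ B ψ j k ≉ 0#
            Δψ≉0 Δψ≈0 = Δφ≉0 (trans (Δ≈ j k) Δψ≈0)

        GaugeRescaled⇒GramRescaled : (∀ j k → Δ B φ j k ≈ Δ B ψ j k) → GaugeRescaled β φ ψ →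
                                     GramRescaled β φ ψ
        GaugeRescaled⇒GramRescaled Δ≈ rescaled j k =
          [ Δ≈0-case , Δ≉0-case ]′ (toSum (Δ B φ j k ≟ 0#))
          where
          Δ≈0-case : Δ B φ j k ≈ 0# → B (ψ j) (ψ k) ≈ (σ (β j) * β k) * B (φ j) (φ k)
          Δ≈0-case Δφ≈0 = begin
            B (ψ j) (ψ k)                    ≈⟨ B*B≈0⇒B≈0 (ψ j) (ψ k) (trans (sym (Δ≈ j k)) Δφ≈0) ⟩
            0#                               ≈⟨ zeroʳ _ ⟨
            (σ (β j) * β k) * 0#             ≈⟨ *-congˡ (B*B≈0⇒B≈0 (φ j) (φ k) Δφ≈0) ⟨
            (σ (β j) * β k) * B (φ j) (φ k)  ∎

          Δ≉0-case : Δ B φ j k ≉ 0# → B (ψ j) (ψ k) ≈ (σ (β j) * β k) * B (φ j) (φ k)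
          Δ≉0-case Δφ≉0 = begin
            B (ψ j) (ψ k)                                         ≈⟨ η-polar ψ j k Δψ≉0 ⟨
            η B sqrt ψ j k * sqrt (Δ B ψ j k)                     ≈⟨ *-cong (rescaled j k) (sqrt-cong (sym (Δ≈ j k))) ⟩
            ((η B sqrt φ j k * σ (β j)) * β k) * sqrt (Δ B φ j k)
              ≈⟨ solve 4 (λ a b e s → ((e :* a) :* b) :* s := (a :* b) :* (e :* s))
                       refl (σ (β j)) (β k) (η B sqrt φ j k) (sqrt (Δ B φ j k)) ⟩
            (σ (β j) * β k) * (η B sqrt φ j k * sqrt (Δ B φ j k)) ≈⟨ *-congˡ (η-polar φ j k Δφ≉0) ⟩
            (σ (β j) * β k) * B (φ j) (φ k)                       ∎
            where
            Δψ≉0 : Δ B ψ j k ≉ 0#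
            Δψ≉0 Δψ≈0 = Δφ≉0 (trans (Δ≈ j k) Δψ≈0)

proposition3p9 : ∀ {c ℓ} (F : Field c ℓ) (q : ℕ) → FiniteFieldSetting F q →
    let open Field F
        σ : Carrier → Carrier
        σ x = x ^ q
    in (d n : ℕ) → let open Space F σ d in
    (B : V → V → Carrier) → IsNonIsotropic B →
    (sqrt : Carrier → Carrier) → IsSqrtOnNorms sqrt →
    (φ ψ : Fin n → V) → IsFrame φ → IsFrame ψ →
    SwitchingEquivalent B φ ψ ⇔
      ((∀ j k → Δ B φ j k ≈ Δ B ψ j k)
       × Σ (Fin n → Carrier) λ β → (∀ j → IsUnitScalar (β j)) ×
           (∀ j k → η B sqrt ψ j k ≈ (η B sqrt φ j k * σ (β j)) * β k))
proposition3p9 F q (q-odd , _) d n B B-nonIsotropic sqrt sqrt-spec φ ψ φ-frame ψ-frame =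
  mk⇔ (λ switching →
         let (β , β-unit , Gram-rescaled) = to switching
             Δ≈ = GramRescaled⇒Δ≈ β-unit Gram-rescaled
         in Δ≈ , β , β-unit , GramRescaled⇒GaugeRescaled Δ≈ Gram-rescaled)
      (λ (Δ≈ , β , β-unit , gauge-rescaled) →
         from (β , β-unit , GaugeRescaled⇒GramRescaled Δ≈ gauge-rescaled))
  where
  open HermitianSpace F q q-odd d
  open Form B-nonIsotropic
  open Gauge sqrt-spec
  open Equivalence (switching⇔GramRescaledByUnits φ-frame ψ-frame)
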